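{- Let $p$ be a prime, $k\ge4$, $n\ge1$, $N=p^n$, and $X_1,\dots,X_k\subseteq\mathbb{F}_p^n$. Suppose the number of $k$-cycles in $X_1\times\dots\times X_k$ equals $\delta'N^{k-1}$ with $\delta'>0$, and let $\theta\ge1$ be such that for every $i$, each point of $X_i$ occurs as $x_i$ in at most $\theta\delta'N^{k-2}$ $k$-cycles of $X_1\times\dots\times X_k$. Let $\alpha=(\theta\delta')^{1/(k-2)}$ and let $\ell$ be an integer with $2\le\ell\le k-2$. Let $M^0$ be the set of $k$-cycles $(x_1,\dots,x_k)\in X_1\times\dots\times X_k$ such that $(x_1,\dots,x_\ell)$ is a bad $[\ell]$-tuple and $(x_1,\dots,x_{\ell-1})$ is not a bad $[\ell-1]$-tuple. Let $M'$ be the set of $(x_1,\dots,x_k)\in M^0$ such that for every $j=\ell+2,\dots,k$, the tuple $(x_1,\dots,x_{\ell-1},x_j)$ is a bad $([\ell-1]\cup\{j\})$-tuple. Then $|M'|\le\frac12|M^0|$.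
   Context: A $k$-cycle is a tuple $(x_1,\dots,x_k)\in X_1\times\dots\times X_k$ with $x_1+\dots+x_k=0$. $[m]=\{1,\dots,m\}$. For $I\subseteq[k]$ with $1\le|I|\le k-2$, an $I$-tuple is an element $(x_i)_{i\in I}\in\prod_{i\in I}X_i$; it is bad if there are at least $2\alpha^{k-|I|-1}N^{k-|I|-1}$ $k$-cycles $(x_1,\dots,x_k)\in X_1\times\dots\times X_k$ agreeing with it on the coordinates in $I$.
   Formalization: The parameter θ ≥ 1 ranges over the rationals instead of the reals. -}

module Defs where

-- Conventions:
--  * F_p^n is represented as  Vec (Fin p) n ; a sum of points is zero iff in
--    every coordinate the sum of the (natural-number) representatives is
--    divisible by p.
--  * Indices [k] = {1..k} of the paper are represented by Fin k (0-based):
--    paper index i  <->  Fin element with toℕ = i - 1.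
--  * Subsets X_1..X_k of F_p^n are given by characteristic functions
--    X : Fin k → Point p n → Bool.
--  * A k-tuple (x_1,..,x_k) is a function  Fin k → Point p n.
--  * Index sets I ⊆ [k] are  Subset k  (Data.Fin.Subset).  An I-tuple is
--    represented by any k-tuple y, of which only the coordinates in I matter.

open import Data.Bool using (Bool; true)
open import Data.Nat as ℕ using (ℕ; zero; suc; _∸_; _<ᵇ_)
open import Data.Nat.Divisibility using (_∣_; _∣?_)
open import Data.Fin using (Fin; toℕ)
import Data.Fin.Properties as FinP
open import Data.Fin.Subset using (Subset; _∈_; ∣_∣; _∪_; ⁅_⁆)
open import Data.Fin.Subset.Properties using (_∈?_)
open import Data.Vec using (Vec; []; _∷_; lookup; tabulate)
import Data.Vec.Properties as VecP
open import Data.Vec.Functional using () renaming (_∷_ to _∷ᶠ_)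
open import Data.List using (List; [_]; map; concatMap; allFin; filter; length)
open import Data.Integer using (+_)
open import Data.Rational using (ℚ; _*_; _≤_; _/_; 1ℚ)
open import Data.Rational.Properties using (_≤?_)
open import Data.Product using (_×_)
open import Relation.Nullary using (¬_; Dec)
open import Relation.Nullary.Decidable using (_×-dec_; ¬?; _→-dec_)
open import Relation.Binary.PropositionalEquality using (_≡_)
open import Data.Bool.Properties using () renaming (_≟_ to _≟ᵇ_)

ℕtoℚ : ℕ → ℚ
ℕtoℚ m = (+ m) / 1

_^ℚ_ : ℚ → ℕ → ℚ
q ^ℚ zero  = 1ℚ
q ^ℚ suc m = q * (q ^ℚ m)

sumFin : ∀ k → (Fin k → ℕ) → ℕ
sumFin zero    f = 0
sumFin (suc k) f = f Fin.zero ℕ.+ sumFin k (λ i → f (Fin.suc i))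
  where import Data.Fin as Fin

Point : ℕ → ℕ → Set
Point p n = Vec (Fin p) n

allPoints : ∀ p n → List (Point p n)
allPoints p zero    = [ [] ]
allPoints p (suc n) = concatMap (λ a → map (a ∷_) (allPoints p n)) (allFin p)

allFuns : ∀ {A : Set} k → List A → List (Fin k → A)
allFuns zero    xs = [ (λ ()) ]
allFuns (suc k) xs = concatMap (λ a → map (a ∷ᶠ_) (allFuns k xs)) xs

-- [m] = {1,..,m} as a subset of [k]  (0-based: toℕ i < m)
initSeg : ∀ {k} → ℕ → Subset k
initSeg m = tabulate (λ i → toℕ i <ᵇ m)

module Setup (p n k : ℕ) (X : Fin k → Point p n → Bool) where

  N : ℕ
  N = p ℕ.^ n

  Tuple : Set
  Tuple = Fin k → Point p n

  SumZero : Tuple → Set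
  SumZero x = ∀ (c : Fin n) → p ∣ sumFin k (λ i → toℕ (lookup (x i) c))

  IsCycle : Tuple → Set
  IsCycle x = (∀ i → X i (x i) ≡ true) × SumZero x

  isCycle? : ∀ x → Dec (IsCycle x)
  isCycle? x = FinP.all? (λ i → X i (x i) ≟ᵇ true)
         ×-dec FinP.all? (λ c → p ∣? sumFin k (λ i → toℕ (lookup (x i) c)))

  cycles : List Tuple
  cycles = filter isCycle? (allFuns k (allPoints p n))

  numCycles : ℕ
  numCycles = length cycles

  numCyclesAt : Fin k → Point p n → ℕ
  numCyclesAt i v = length (filter (λ x → VecP.≡-dec FinP._≟_ (x i) v) cycles)

  AgreeOn : Subset k → Tuple → Tuple → Set
  AgreeOn I y x = ∀ i → i ∈ I → x i ≡ y i

  agreeOn? : ∀ I y x → Dec (AgreeOn I y x)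
  agreeOn? I y x = FinP.all? (λ i → (i ∈? I) →-dec VecP.≡-dec FinP._≟_ (x i) (y i))

  numExt : Subset k → Tuple → ℕ
  numExt I y = length (filter (agreeOn? I y) cycles)

  -- With  α = (θ δ')^(1/(k-2))  and  m = k - |I| - 1, the I-tuple
  -- is bad iff  numExt ≥ 2 α^m N^m.  As both sides are ≥ 0 and k - 2 ≥ 1,
  -- this is equivalent to  (2 N^m)^(k-2) (θ δ')^m ≤ numExt^(k-2),
  -- which is how it is stated (θ, δ' rational).
  Bad : (θ δ' : ℚ) → Subset k → Tuple → Set
  Bad θ δ' I y =
    let m = k ∸ ∣ I ∣ ∸ 1 in
    (ℕtoℚ (2 ℕ.* N ℕ.^ m) ^ℚ (k ∸ 2)) * ((θ * δ') ^ℚ m)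
      ≤ ℕtoℚ (numExt I y) ^ℚ (k ∸ 2)

  bad? : ∀ θ δ' I y → Dec (Bad θ δ' I y)
  bad? θ δ' I y = _ ≤? _

  InM0 : (θ δ' : ℚ) (ℓ : ℕ) → Tuple → Set
  InM0 θ δ' ℓ x = Bad θ δ' (initSeg ℓ) x × ¬ Bad θ δ' (initSeg (ℓ ∸ 1)) x

  inM0? : ∀ θ δ' ℓ x → Dec (InM0 θ δ' ℓ x)
  inM0? θ δ' ℓ x = bad? θ δ' (initSeg ℓ) x ×-dec ¬? (bad? θ δ' (initSeg (ℓ ∸ 1)) x)

  -- M': elements of M^0 such that for all j = ℓ+2..k (paper indexing,
  -- i.e. toℕ j ≥ ℓ+1 in 0-based indexing) (x_1..x_{ℓ-1}, x_j) is a bad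
  -- ([ℓ-1] ∪ {j})-tuple
  InM' : (θ δ' : ℚ) (ℓ : ℕ) → Tuple → Set
  InM' θ δ' ℓ x = InM0 θ δ' ℓ x
    × (∀ (j : Fin k) → suc ℓ ℕ.≤ toℕ j → Bad θ δ' (initSeg (ℓ ∸ 1) ∪ ⁅ j ⁆) x)

  inM'? : ∀ θ δ' ℓ x → Dec (InM' θ δ' ℓ x)
  inM'? θ δ' ℓ x = inM0? θ δ' ℓ x
    ×-dec FinP.all? (λ j → (suc ℓ ℕ.≤? toℕ j) →-dec bad? θ δ' (initSeg (ℓ ∸ 1) ∪ ⁅ j ⁆) x)

  sizeM0 : (θ δ' : ℚ) (ℓ : ℕ) → ℕ
  sizeM0 θ δ' ℓ = length (filter (inM0? θ δ' ℓ) cycles)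

  sizeM' : (θ δ' : ℚ) (ℓ : ℕ) → ℕ
  sizeM' θ δ' ℓ = length (filter (inM'? θ δ' ℓ) cycles)

module Submission where

-- Split the cycles into classes according to their first ℓ coordinates; it suffices that
-- 2|M' ∩ C| ≤ |M^0 ∩ C| for every class C (count-half-by-classes).  Classes outside M^0 contain no
-- element of M'.  For a class with representative z ∈ M^0, every cycle extending the bad [ℓ]-tuple
-- z_[ℓ] lies in M^0, so |M^0 ∩ C| = numExt [ℓ] z ≥ 2 (αN)^m  with  m = k - ℓ - 1.  A cycle of M' ∩ C
-- agrees with z on [ℓ], its coordinate ℓ+1 is determined by the others (the sum is zero), and each
-- coordinate j ≥ ℓ+2 is one of the D_j values v making (z_[ℓ-1], v) bad.  As z_[ℓ-1] is not bad and
-- the extensions of these bad tuples are disjoint, D_j ≤ αN; hence |M' ∩ C| ≤ ∏ D_j ≤ (αN)^m.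
-- Inequalities involving α are handled raised to the power K = k - 2, as in the definition of Bad.

open import Data.Bool using (Bool; true; T; if_then_else_)
open import Data.Empty using (⊥-elim)
open import Data.Unit using (⊤; tt)
open import Data.Product using (Σ; _×_; _,_; proj₁; proj₂)
open import Data.Sum using (inj₁; inj₂)
open import Function using (_∘_; const)
open import Data.Nat using (ℕ; zero; suc; _+_; _*_; _^_; _∸_; NonZero; >-nonZero; _≤_; _<_; z≤n; s≤s; _<?_)
open import Data.Nat.Properties
open import Data.Nat.Solver using (module +-*-Solver)
open +-*-Solver using (solve; _:+_; _:=_)
open import Data.Nat.Divisibility using (_∣_; ∣1⇒≡1)
open import Data.Nat.DivMod using (_%_; %-remove-+ˡ; m<n⇒m%n≡m)
open import Data.Nat.Coprimality using (Coprime)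
open import Data.Nat.Primality using (Prime; prime⇒nonZero)
import Data.Integer as ℤ
import Data.Integer.Properties as ℤP
open import Data.Rational as ℚ using (ℚ; mkℚ; 0ℚ; 1ℚ; _/_; *≤*; *<*)
  renaming (_≤_ to _≤ℚ_; _<_ to _<ℚ_; _*_ to _*ℚ_)
import Data.Rational.Properties as ℚP
open import Data.Fin using (Fin; zero; suc; toℕ; fromℕ<)
import Data.Fin.Properties as FinP
open FinP using () renaming (suc-injective to Fin-suc-injective)
open import Data.Fin.Subset using (Subset; ∣_∣; _∪_; ⁅_⁆) renaming (_∈_ to _∈ₛ_; _∉_ to _∉ₛ_; ⊥ to ∅)
open import Data.Fin.Subset.Properties using (x∈p∪q⁻; x∈p∪q⁺; x∈⁅y⁆⇒x≡y; x∈⁅x⁆)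
open import Data.Vec using (_∷_; lookup; tabulate)
import Data.Vec.Properties as VecP
open import Data.Vec.Functional using (updateAt) renaming (_∷_ to _∷ᶠ_)
open import Data.Vec.Functional.Properties using (updateAt-updates; updateAt-minimal)
open import Data.List using (List; []; _∷_; filter; length; map; concatMap; _++_)
open import Data.List.Properties
  using (length-filter; filter-accept; filter-reject; filter-none; filter-some; filter-≐; filter-++; length-++)
open import Data.List.Membership.Propositional using (_∈_)
open import Data.List.Membership.Propositional.Properties using (∈-filter⁻; ∈-map⁻)
open import Data.List.Relation.Unary.Any as Any using (here)
open import Data.List.Relation.Unary.All as All using (All; []; _∷_)
import Data.List.Relation.Unary.All.Properties as AllP
open import Data.List.Relation.Unary.AllPairs as AllPairs using ([]; _∷_)
import Data.List.Relation.Unary.AllPairs.Properties as AllPairsP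
open import Data.List.Relation.Unary.Unique.Propositional using (Unique)
import Data.List.Relation.Unary.Unique.Propositional.Properties as UniqueP
open import Data.List.Relation.Binary.Disjoint.Propositional using (Disjoint)
open import Data.List.Relation.Binary.Sublist.Propositional using (⊆-refl)
open import Data.List.Relation.Binary.Sublist.Propositional.Properties using (filter⁺; length-mono-≤)
open import Data.List.Extrema.Nat using (argmin; argmin-all; f[argmin]≤f[⊤]; f[argmin]≤f[xs])
open import Relation.Nullary using (¬_; Dec; yes; no)
open import Relation.Nullary.Decidable using (_×-dec_; _→-dec_; does; dec-true; dec-false)
open import Relation.Unary using (Decidable)
open import Relation.Unary.Properties using (_∩?_; ∁?)
open import Relation.Binary.Definitions using (DecidableEquality; Tri; tri<; tri≈; tri>)
open import Relation.Binary.Structures using (IsEquivalence)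
open import Relation.Binary.PropositionalEquality
open import Defs using (Point; allPoints; allFuns; sumFin; initSeg; ℕtoℚ; _^ℚ_; module Setup)

private variable A B : Set

count : {P : A → Set} → Decidable P → List A → ℕ
count P? xs = length (filter P? xs)

count-accept : {P : A → Set} (P? : Decidable P) → ∀ {x} xs → P x → count P? (x ∷ xs) ≡ suc (count P? xs)
count-accept P? xs px = cong length (filter-accept P? px)

count-reject : {P : A → Set} (P? : Decidable P) → ∀ {x} xs → ¬ P x → count P? (x ∷ xs) ≡ count P? xs
count-reject P? xs ¬px = cong length (filter-reject P? ¬px)

count-none : {P : A → Set} (P? : Decidable P) → (∀ x → ¬ P x) → ∀ xs → count P? xs ≡ 0
count-none P? ¬P xs = cong length (filter-none P? (All.universal ¬P xs))

count-split : {P R : A → Set} (P? : Decidable P) (R? : Decidable R) → ∀ xs →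
  count P? xs ≡ count (P? ∩? R?) xs + count (P? ∩? ∁? R?) xs
count-split P? R? [] = refl
count-split {P = P} {R} P? R? (x ∷ xs) = step (P? x) (R? x)
  where
  ih = count-split P? R? xs
  step : Dec (P x) → Dec (R x) → count P? (x ∷ xs) ≡ count (P? ∩? R?) (x ∷ xs) + count (P? ∩? ∁? R?) (x ∷ xs)
  step (yes px) (yes rx) = trans (count-accept P? xs px) (trans (cong suc ih)
    (cong₂ _+_ (sym (count-accept (P? ∩? R?) xs (px , rx))) (sym (count-reject (P? ∩? ∁? R?) xs (λ q → proj₂ q rx)))))
  step (yes px) (no ¬rx) = trans (count-accept P? xs px) (trans (cong suc ih) (trans (sym (+-suc _ _))
    (cong₂ _+_ (sym (count-reject (P? ∩? R?) xs (λ q → ¬rx (proj₂ q)))) (sym (count-accept (P? ∩? ∁? R?) xs (px , ¬rx))))))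
  step (no ¬px) _ = trans (count-reject P? xs ¬px) (trans ih
    (cong₂ _+_ (sym (count-reject (P? ∩? R?) xs (λ q → ¬px (proj₁ q))))
               (sym (count-reject (P? ∩? ∁? R?) xs (λ q → ¬px (proj₁ q))))))

module _ {P Q : A → Set} (P? : Decidable P) (Q? : Decidable Q) where

  count-mono : (∀ x → P x → Q x) → ∀ xs → count P? xs ≤ count Q? xs
  count-mono P⇒Q xs = length-mono-≤ (filter⁺ P? Q? (λ { refl → P⇒Q _ }) (⊆-refl {x = xs}))

  count-cong : (∀ x → P x → Q x) → (∀ x → Q x → P x) → ∀ xs → count P? xs ≡ count Q? xs
  count-cong P⇒Q Q⇒P xs = cong length (filter-≐ P? Q? ((λ {x} → P⇒Q x) , (λ {x} → Q⇒P x)) xs)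

module _ {P : A → Set} (P? : Decidable P) where

  count-witness : ∀ xs → 0 < count P? xs → Σ A (λ x → x ∈ xs × P x)
  count-witness xs pos with filter P? xs in eq
  ... | y ∷ _ = y , ∈-filter⁻ P? (subst (y ∈_) (sym eq) (here refl))

  count-member : ∀ {x} xs → x ∈ xs → P x → 0 < count P? xs
  count-member xs x∈ px = filter-some P? (Any.map (λ { refl → px }) x∈)

  count-subsingleton : (∀ {x y} → P x → P y → x ≡ y) → ∀ xs → Unique xs → count P? xs ≤ 1
  count-subsingleton unique [] [] = z≤n
  count-subsingleton unique (x ∷ xs) (x∉xs ∷ u) with P? x
  ... | yes px = s≤s (≤-reflexive (cong length (filter-none P? (All.map (λ x≢y py → x≢y (unique px py)) x∉xs))))
  ... | no ¬px = count-subsingleton unique xs u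

count-filter : {P R : A → Set} (P? : Decidable P) (R? : Decidable R) → ∀ xs →
  count P? (filter R? xs) ≡ count (P? ∩? R?) xs
count-filter P? R? [] = refl
count-filter {P = P} {R} P? R? (x ∷ xs) = step (R? x) (P? x)
  where
  ih = count-filter P? R? xs
  step : Dec (R x) → Dec (P x) → count P? (filter R? (x ∷ xs)) ≡ count (P? ∩? R?) (x ∷ xs)
  step (yes rx) (yes px) = trans (cong (count P?) (filter-accept R? rx))
    (trans (count-accept P? (filter R? xs) px) (trans (cong suc ih) (sym (count-accept (P? ∩? R?) xs (px , rx)))))
  step (yes rx) (no ¬px) = trans (cong (count P?) (filter-accept R? rx))
    (trans (count-reject P? (filter R? xs) ¬px) (trans ih (sym (count-reject (P? ∩? R?) xs (λ q → ¬px (proj₁ q))))))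
  step (no ¬rx) _ = trans (cong (count P?) (filter-reject R? ¬rx))
    (trans ih (sym (count-reject (P? ∩? R?) xs (λ q → ¬rx (proj₂ q)))))

sumOver : List A → (A → ℕ) → ℕ
sumOver []       f = 0
sumOver (x ∷ xs) f = f x + sumOver xs f

sumOver-cong : ∀ (xs : List A) {f g : A → ℕ} → (∀ x → f x ≡ g x) → sumOver xs f ≡ sumOver xs g
sumOver-cong []       f≗g = refl
sumOver-cong (x ∷ xs) f≗g = cong₂ _+_ (f≗g x) (sumOver-cong xs f≗g)

sumOver-+ : ∀ (xs : List A) (f g : A → ℕ) → sumOver xs (λ x → f x + g x) ≡ sumOver xs f + sumOver xs g
sumOver-+ []       f g = refl
sumOver-+ (x ∷ xs) f g = trans (cong ((f x + g x) +_) (sumOver-+ xs f g)) (+-+-comm (f x) (g x) (sumOver xs f) (sumOver xs g))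
  where
  +-+-comm : ∀ a b c d → a + b + (c + d) ≡ a + c + (b + d)
  +-+-comm a b c d = solve 4 (λ a b c d → a :+ b :+ (c :+ d) := a :+ c :+ (b :+ d)) refl a b c d

length*min≤sumOver : ∀ (xs : List A) {f : A → ℕ} {μ} → All (λ x → μ ≤ f x) xs → length xs * μ ≤ sumOver xs f
length*min≤sumOver []       []         = z≤n
length*min≤sumOver (x ∷ xs) (μ≤ ∷ μ≤s) = +-mono-≤ μ≤ (length*min≤sumOver xs μ≤s)

sumOver≤count* : {Q : A → Set} (Q? : Decidable Q) {f : A → ℕ} (W : ℕ) →
  (∀ x → Q x → f x ≤ W) → (∀ x → ¬ Q x → f x ≡ 0) → ∀ xs → sumOver xs f ≤ count Q? xs * W
sumOver≤count* Q? W on off [] = z≤n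
sumOver≤count* Q? W on off (x ∷ xs) with Q? x
... | yes qx = +-mono-≤ (on x qx) (sumOver≤count* Q? W on off xs)
... | no ¬qx rewrite off x ¬qx = sumOver≤count* Q? W on off xs

indicator : {P : Set} → Dec P → ℕ
indicator (yes _) = 1
indicator (no _)  = 0

count-∷ : {P : A → Set} (P? : Decidable P) → ∀ x xs → count P? (x ∷ xs) ≡ indicator (P? x) + count P? xs
count-∷ P? x xs with P? x
... | yes _ = refl
... | no _  = refl

count-as-sum : {P : A → Set} (P? : Decidable P) → ∀ xs → count P? xs ≡ sumOver xs (λ x → indicator (P? x))
count-as-sum P? []       = refl
count-as-sum P? (x ∷ xs) = trans (count-∷ P? x xs) (cong (indicator (P? x) +_) (count-as-sum P? xs))

sumOver-zero : ∀ (xs : List A) → sumOver xs (λ _ → 0) ≡ 0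
sumOver-zero []       = refl
sumOver-zero (x ∷ xs) = sumOver-zero xs

count-swap : {R : A → B → Set} (R? : ∀ a b → Dec (R a b)) → ∀ (xs : List A) (ys : List B) →
  sumOver xs (λ a → count (R? a) ys) ≡ sumOver ys (λ b → count (λ a → R? a b) xs)
count-swap R? []       ys = sym (sumOver-zero ys)
count-swap R? (x ∷ xs) ys = begin
  count (R? x) ys + sumOver xs (λ a → count (R? a) ys)
    ≡⟨ cong₂ _+_ (count-as-sum (R? x) ys) (count-swap R? xs ys) ⟩
  sumOver ys (λ b → indicator (R? x b)) + sumOver ys (λ b → count (λ a → R? a b) xs)
    ≡⟨ sym (sumOver-+ ys _ _) ⟩
  sumOver ys (λ b → indicator (R? x b) + count (λ a → R? a b) xs)
    ≡⟨ sumOver-cong ys (λ b → sym (count-∷ (λ a → R? a b) x xs)) ⟩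
  sumOver ys (λ b → count (λ a → R? a b) (x ∷ xs)) ∎
  where open ≡-Reasoning

count-++ : {P : A → Set} (P? : Decidable P) → ∀ xs ys → count P? (xs ++ ys) ≡ count P? xs + count P? ys
count-++ P? xs ys = trans (cong length (filter-++ P? xs ys)) (length-++ (filter P? xs))

count-map : {P : B → Set} (P? : Decidable P) (f : A → B) → ∀ xs → count P? (map f xs) ≡ count (λ x → P? (f x)) xs
count-map P? f []       = refl
count-map P? f (x ∷ xs) = trans (count-∷ P? (f x) (map f xs)) (trans (cong (indicator (P? (f x)) +_) (count-map P? f xs))
  (sym (count-∷ (λ x → P? (f x)) x xs)))

count-concatMap : {P : B → Set} (P? : Decidable P) (f : A → List B) → ∀ xs →
  count P? (concatMap f xs) ≡ sumOver xs (λ x → count P? (f x))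
count-concatMap P? f []       = refl
count-concatMap P? f (x ∷ xs) = trans (count-++ P? (f x) (concatMap f xs)) (cong (count P? (f x) +_) (count-concatMap P? f xs))

module _ {R : A → A → Set} (R? : ∀ a b → Dec (R a b)) (R-equiv : IsEquivalence R)
         {P Q : A → Set} (P? : Decidable P) (Q? : Decidable Q) (xs : List A)
         (classwise : ∀ z → 2 * count (Q? ∩? R? z) xs ≤ count (P? ∩? R? z) xs) where

  private
    module R = IsEquivalence R-equiv

    -- Unions of classes are the R-invariant predicates.
    Invariant : (A → Set) → Set
    Invariant S = ∀ {a b} → R a b → S a → S b

    split-class : ∀ {T S : A → Set} (T? : Decidable T) (S? : Decidable S) → Invariant S → ∀ {x} → S x →
      count (T? ∩? S?) xs ≡ count (T? ∩? R? x) xs + count (T? ∩? (S? ∩? ∁? (R? x))) xs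
    split-class T? S? inv {x} sx = trans (count-split (T? ∩? S?) (R? x) xs) (cong₂ _+_
      (count-cong _ _ (λ _ q → proj₁ (proj₁ q) , proj₂ q) (λ _ q → (proj₁ q , inv (proj₂ q) sx) , proj₂ q) xs)
      (count-cong _ _ (λ _ q → proj₁ (proj₁ q) , proj₂ (proj₁ q) , proj₂ q)
                      (λ _ q → (proj₁ q , proj₁ (proj₂ q)) , proj₂ (proj₂ q)) xs))

    within : ∀ n {S : A → Set} (S? : Decidable S) → Invariant S → count S? xs ≤ n →
      2 * count (Q? ∩? S?) xs ≤ count (P? ∩? S?) xs
    within n S? inv bound with 0 <? count S? xs
    ... | no empty = ≤-trans (≤-reflexive (cong (2 *_) (n≤0⇒n≡0
          (≤-trans (count-mono (Q? ∩? S?) S? (λ _ → proj₂) xs) (≮⇒≥ empty))))) z≤n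
    within zero    S? inv bound | yes nonempty = ⊥-elim (<-irrefl refl (<-≤-trans nonempty bound))
    within (suc n) {S} S? inv bound | yes nonempty with count-witness S? xs nonempty
    ... | x , x∈xs , sx = begin
      2 * count (Q? ∩? S?) xs
        ≡⟨ cong (2 *_) (split-class Q? S? inv sx) ⟩
      2 * (count (Q? ∩? R? x) xs + count (Q? ∩? S'?) xs)
        ≡⟨ *-distribˡ-+ 2 (count (Q? ∩? R? x) xs) (count (Q? ∩? S'?) xs) ⟩
      2 * count (Q? ∩? R? x) xs + 2 * count (Q? ∩? S'?) xs
        ≤⟨ +-mono-≤ (classwise x) (within n S'? inv' bound') ⟩
      count (P? ∩? R? x) xs + count (P? ∩? S'?) xs
        ≡⟨ sym (split-class P? S? inv sx) ⟩
      count (P? ∩? S?) xs ∎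
      where
      open ≤-Reasoning
      S'? = S? ∩? ∁? (R? x)
      inv' : Invariant (λ y → S y × ¬ R x y)
      inv' rab (sa , ¬rxa) = inv rab sa , (λ rxb → ¬rxa (R.trans rxb (R.sym rab)))
      bound' : count S'? xs ≤ n
      bound' = ≤-pred (begin
        suc (count S'? xs)                         ≤⟨ +-monoˡ-≤ _ (count-member (S? ∩? R? x) xs x∈xs (sx , R.refl)) ⟩
        count (S? ∩? R? x) xs + count S'? xs       ≡⟨ sym (count-split S? (R? x) xs) ⟩
        count S? xs                                ≤⟨ bound ⟩
        suc n ∎)

  count-half-by-classes : 2 * count Q? xs ≤ count P? xs
  count-half-by-classes = begin
    2 * count Q? xs                ≡⟨ cong (2 *_) (count-cong Q? (Q? ∩? U?) (λ _ q → q , tt) (λ _ → proj₁) xs) ⟩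
    2 * count (Q? ∩? U?) xs        ≤⟨ within (count U? xs) U? (λ _ _ → tt) ≤-refl ⟩
    count (P? ∩? U?) xs            ≡⟨ count-cong (P? ∩? U?) P? (λ _ → proj₁) (λ _ p → p , tt) xs ⟩
    count P? xs ∎
    where
    open ≤-Reasoning
    U? : Decidable (λ (_ : A) → ⊤)
    U? _ = yes tt

productFin : ∀ k → (Fin k → ℕ) → ℕ
productFin zero    w = 1
productFin (suc k) w = w zero * productFin k (λ i → w (suc i))

module FunctionCount (Vs : List A) (Vs-unique : Unique Vs) where

  count-allFuns-suc : ∀ {k} {P : (Fin (suc k) → A) → Set} (P? : Decidable P) →
    count P? (allFuns (suc k) Vs) ≡ sumOver Vs (λ a → count (λ r → P? (a ∷ᶠ r)) (allFuns k Vs))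
  count-allFuns-suc {k} P? = trans (count-concatMap P? (λ a → map (a ∷ᶠ_) (allFuns k Vs)) Vs)
    (sumOver-cong Vs (λ a → count-map P? (a ∷ᶠ_) (allFuns k Vs)))

  count-allFuns-step : ∀ {k} {P : (Fin (suc k) → A) → Set} (P? : Decidable P) {Q : A → Set} (Q? : Decidable Q) W →
    (∀ a r → P (a ∷ᶠ r) → Q a) → (∀ a → Q a → count (λ r → P? (a ∷ᶠ r)) (allFuns k Vs) ≤ W) →
    count P? (allFuns (suc k) Vs) ≤ count Q? Vs * W
  count-allFuns-step {k} P? Q? W head extensions = subst (_≤ count Q? Vs * W) (sym (count-allFuns-suc P?))
    (sumOver≤count* Q? W extensions (λ a ¬qa → count-none (λ r → P? (a ∷ᶠ r)) (λ r pr → ¬qa (head a r pr)) (allFuns k Vs)) Vs)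

  count-box : ∀ k {P : (Fin k → A) → Set} (P? : Decidable P) {Q : Fin k → A → Set} (Q? : ∀ i → Decidable (Q i))
    (w : Fin k → ℕ) → (∀ i → count (Q? i) Vs ≤ w i) → (∀ f → P f → ∀ i → Q i (f i)) →
    count P? (allFuns k Vs) ≤ productFin k w
  count-box zero    P? Q? w sizes inBox = length-filter P? (allFuns zero Vs)
  count-box (suc k) P? Q? w sizes inBox = ≤-trans
    (count-allFuns-step P? (Q? zero) W (λ a r pr → inBox (a ∷ᶠ r) pr zero)
      (λ a _ → count-box k (λ r → P? (a ∷ᶠ r)) (λ i → Q? (suc i)) (λ i → w (suc i)) (λ i → sizes (suc i))
                 (λ r pr i → inBox (a ∷ᶠ r) pr (suc i))))
    (*-monoˡ-≤ W (sizes zero))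
    where W = productFin k (λ i → w (suc i))

  -- The same bound when the coordinate d is not constrained by Q but is determined by the others
  -- (so it needs only the factor  w d ≥ 1).
  count-box-determined : ∀ k (d : Fin k) {P : (Fin k → A) → Set} (P? : Decidable P) {Q : Fin k → A → Set}
    (Q? : ∀ i → Decidable (Q i)) (w : Fin k → ℕ) → 1 ≤ w d → (∀ i → i ≢ d → count (Q? i) Vs ≤ w i) →
    (∀ f → P f → ∀ i → i ≢ d → Q i (f i)) →
    (∀ {f g} → P f → P g → (∀ i → i ≢ d → f i ≡ g i) → f d ≡ g d) →
    count P? (allFuns k Vs) ≤ productFin k w
  count-box-determined (suc k) zero {P} P? {Q} Q? w 1≤wd sizes inBox determined = begin
    count P? (allFuns (suc k) Vs)                               ≡⟨ count-allFuns-suc P? ⟩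
    sumOver Vs (λ a → count (λ r → P? (a ∷ᶠ r)) AF)             ≡⟨ count-swap (λ a r → P? (a ∷ᶠ r)) Vs AF ⟩
    sumOver AF (λ r → count (λ a → P? (a ∷ᶠ r)) Vs)             ≤⟨ sumOver≤count* T? 1 atMostOne unextendable AF ⟩
    count T? AF * 1                                             ≡⟨ *-identityʳ _ ⟩
    count T? AF                                                 ≤⟨ count-box k T? (λ i → Q? (suc i)) (λ i → w (suc i))
                                                                     (λ i → sizes (suc i) (λ ())) inBox' ⟩
    W                                                           ≡⟨ *-identityˡ W ⟨
    1 * W                                                       ≤⟨ *-monoˡ-≤ W 1≤wd ⟩
    w zero * W ∎
    where
    open ≤-Reasoning
    AF = allFuns k Vs
    W = productFin k (λ i → w (suc i))
    T? : Decidable (λ r → 0 < count (λ a → P? (a ∷ᶠ r)) Vs)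
    T? r = 0 <? count (λ a → P? (a ∷ᶠ r)) Vs
    atMostOne : ∀ r → 0 < count (λ a → P? (a ∷ᶠ r)) Vs → count (λ a → P? (a ∷ᶠ r)) Vs ≤ 1
    atMostOne r _ = count-subsingleton (λ a → P? (a ∷ᶠ r))
      (λ pa pb → determined pa pb (λ { zero 0≢0 → ⊥-elim (0≢0 refl) ; (suc i) _ → refl })) Vs Vs-unique
    unextendable : ∀ r → ¬ 0 < count (λ a → P? (a ∷ᶠ r)) Vs → count (λ a → P? (a ∷ᶠ r)) Vs ≡ 0
    unextendable r none = n≤0⇒n≡0 (≮⇒≥ none)
    inBox' : ∀ r → 0 < count (λ a → P? (a ∷ᶠ r)) Vs → ∀ i → Q (suc i) (r i)
    inBox' r some i with count-witness (λ a → P? (a ∷ᶠ r)) Vs some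
    ... | a , _ , pa = inBox (a ∷ᶠ r) pa (suc i) (λ ())
  count-box-determined (suc k) (suc d) P? Q? w 1≤wd sizes inBox determined = ≤-trans
    (count-allFuns-step P? (Q? zero) W (λ a r pr → inBox (a ∷ᶠ r) pr zero (λ ()))
      (λ a _ → count-box-determined k d (λ r → P? (a ∷ᶠ r)) (λ i → Q? (suc i)) (λ i → w (suc i)) 1≤wd
                 (λ i i≢d → sizes (suc i) (i≢d ∘ Fin-suc-injective))
                 (λ r pr i i≢d → inBox (a ∷ᶠ r) pr (suc i) (i≢d ∘ Fin-suc-injective))
                 (λ pf pg agree → determined pf pg (λ { zero _ → refl ; (suc i) i≢d → agree i (i≢d ∘ cong suc) }))))
    (*-monoˡ-≤ W (sizes zero (λ ())))
    where W = productFin k (λ i → w (suc i))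

private
  coprime-1 : ∀ a → Coprime a 1
  coprime-1 a (_ , d∣1) = ∣1⇒≡1 d∣1

  ℕtoℚ-normal : ∀ a → ℕtoℚ a ≡ mkℚ (ℤ.+ a) 0 (coprime-1 a)
  ℕtoℚ-normal a = ℚP.normalize-coprime (coprime-1 a)

ℕtoℚ-* : ∀ a b → ℕtoℚ (a * b) ≡ ℕtoℚ a *ℚ ℕtoℚ b
ℕtoℚ-* a b rewrite ℕtoℚ-normal a | ℕtoℚ-normal b = cong (λ z → z / 1) (ℤP.pos-* a b)

ℕtoℚ-^ : ∀ a K → ℕtoℚ a ^ℚ K ≡ ℕtoℚ (a ^ K)
ℕtoℚ-^ a zero    = refl
ℕtoℚ-^ a (suc K) = trans (cong (ℕtoℚ a *ℚ_) (ℕtoℚ-^ a K)) (sym (ℕtoℚ-* a (a ^ K)))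

ℕtoℚ-mono-≤ : ∀ {a b} → a ≤ b → ℕtoℚ a ≤ℚ ℕtoℚ b
ℕtoℚ-mono-≤ {a} {b} a≤b rewrite ℕtoℚ-normal a | ℕtoℚ-normal b = *≤* (ℤP.*-monoʳ-≤-nonNeg (ℤ.+ 1) (ℤ.+≤+ a≤b))

ℕtoℚ-mono-< : ∀ {a b} → a < b → ℕtoℚ a <ℚ ℕtoℚ b
ℕtoℚ-mono-< {a} {b} a<b rewrite ℕtoℚ-normal a | ℕtoℚ-normal b =
  *<* (subst₂ ℤ._<_ (sym (ℤP.*-identityʳ (ℤ.+ a))) (sym (ℤP.*-identityʳ (ℤ.+ b))) (ℤ.+<+ a<b))

ℕtoℚ-cancel-≤ : ∀ {a b} → ℕtoℚ a ≤ℚ ℕtoℚ b → a ≤ b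
ℕtoℚ-cancel-≤ {a} {b} h rewrite ℕtoℚ-normal a | ℕtoℚ-normal b with h
... | *≤* q = ℤP.drop‿+≤+ (subst₂ ℤ._≤_ (ℤP.*-identityʳ (ℤ.+ a)) (ℤP.*-identityʳ (ℤ.+ b)) q)

ℕtoℚ-nonNeg : ∀ a → 0ℚ ≤ℚ ℕtoℚ a
ℕtoℚ-nonNeg a = ℕtoℚ-mono-≤ {0} {a} z≤n

*-pos : ∀ {x y} → 0ℚ <ℚ x → 0ℚ <ℚ y → 0ℚ <ℚ x *ℚ y
*-pos {x} {y} x>0 y>0 = ℚP.positive⁻¹ (x *ℚ y) {{ℚP.pos*pos⇒pos x {{ℚ.positive x>0}} y {{ℚ.positive y>0}}}}

*-nonNeg : ∀ {x y} → 0ℚ ≤ℚ x → 0ℚ ≤ℚ y → 0ℚ ≤ℚ x *ℚ y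
*-nonNeg {x} {y} x≥0 y≥0 =
  ℚP.nonNegative⁻¹ (x *ℚ y) {{ℚP.nonNeg*nonNeg⇒nonNeg x {{ℚ.nonNegative x≥0}} y {{ℚ.nonNegative y≥0}}}}

^-pos : ∀ {x} m → 0ℚ <ℚ x → 0ℚ <ℚ x ^ℚ m
^-pos zero    x>0 = ℚP.positive⁻¹ 1ℚ
^-pos (suc m) x>0 = *-pos x>0 (^-pos m x>0)

^-nonNeg : ∀ {x} m → 0ℚ ≤ℚ x → 0ℚ ≤ℚ x ^ℚ m
^-nonNeg zero    x≥0 = ℚP.nonNegative⁻¹ 1ℚ
^-nonNeg (suc m) x≥0 = *-nonNeg x≥0 (^-nonNeg m x≥0)

*-mono-≤-nonNeg : ∀ {a b c d} → 0ℚ ≤ℚ a → 0ℚ ≤ℚ d → a ≤ℚ b → c ≤ℚ d → a *ℚ c ≤ℚ b *ℚ d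
*-mono-≤-nonNeg {a} {b} {c} {d} a≥0 d≥0 a≤b c≤d = ℚP.≤-trans
  (ℚP.*-monoˡ-≤-nonNeg a {{ℚ.nonNegative a≥0}} c≤d) (ℚP.*-monoʳ-≤-nonNeg d {{ℚ.nonNegative d≥0}} a≤b)

*-interchange : ∀ a b c d → (a *ℚ b) *ℚ (c *ℚ d) ≡ (a *ℚ c) *ℚ (b *ℚ d)
*-interchange a b c d = begin
  (a *ℚ b) *ℚ (c *ℚ d) ≡⟨ ℚP.*-assoc a b (c *ℚ d) ⟩
  a *ℚ (b *ℚ (c *ℚ d)) ≡⟨ cong (a *ℚ_) (ℚP.*-assoc b c d) ⟨
  a *ℚ ((b *ℚ c) *ℚ d) ≡⟨ cong (λ z → a *ℚ (z *ℚ d)) (ℚP.*-comm b c) ⟩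
  a *ℚ ((c *ℚ b) *ℚ d) ≡⟨ cong (a *ℚ_) (ℚP.*-assoc c b d) ⟩
  a *ℚ (c *ℚ (b *ℚ d)) ≡⟨ ℚP.*-assoc a c (b *ℚ d) ⟨
  (a *ℚ c) *ℚ (b *ℚ d) ∎
  where open ≡-Reasoning

^-distrib-* : ∀ x y K → (x *ℚ y) ^ℚ K ≡ x ^ℚ K *ℚ y ^ℚ K
^-distrib-* x y zero    = sym (ℚP.*-identityˡ 1ℚ)
^-distrib-* x y (suc K) = trans (cong ((x *ℚ y) *ℚ_) (^-distrib-* x y K)) (*-interchange x y (x ^ℚ K) (y ^ℚ K))

0^ℚ : ∀ K → 1 ≤ K → ℕtoℚ 0 ^ℚ K ≡ 0ℚ
0^ℚ (suc K) _ = ℚP.*-zeroˡ (ℕtoℚ 0 ^ℚ K)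

ℕtoℚ-^-mono : ∀ K {a b} → a ≤ b → ℕtoℚ a ^ℚ K ≤ℚ ℕtoℚ b ^ℚ K
ℕtoℚ-^-mono K {a} {b} a≤b rewrite ℕtoℚ-^ a K | ℕtoℚ-^ b K = ℕtoℚ-mono-≤ (^-monoˡ-≤ K a≤b)

-- The badness threshold for m free coordinates, written exactly as in Bad:  (2 N^m)^K c^m,  where in
-- the paper  c = θδ' = α^K  and  K = k - 2.  With  u = N^K c = (αN)^K  it equals  2^K u^m.
module Threshold (N K : ℕ) (c : ℚ) (c>0 : 0ℚ <ℚ c) (N>0 : 0 < N) where

  threshold : ℕ → ℚ
  threshold m = ℕtoℚ (2 * N ^ m) ^ℚ K *ℚ c ^ℚ m

  t : ℚ
  t = ℕtoℚ 2 ^ℚ K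

  u : ℚ
  u = ℕtoℚ (N ^ K) *ℚ c

  t>0 : 0ℚ <ℚ t
  t>0 = ^-pos K (ℕtoℚ-mono-< {0} {2} (s≤s z≤n))

  u>0 : 0ℚ <ℚ u
  u>0 = *-pos (ℕtoℚ-mono-< (m^n>0 N K)) c>0
    where instance _ = >-nonZero N>0

  threshold-closed : ∀ m → threshold m ≡ t *ℚ u ^ℚ m
  threshold-closed m = begin
    ℕtoℚ (2 * N ^ m) ^ℚ K *ℚ c ^ℚ m               ≡⟨ cong (λ z → z ^ℚ K *ℚ c ^ℚ m) (ℕtoℚ-* 2 (N ^ m)) ⟩
    (ℕtoℚ 2 *ℚ ℕtoℚ (N ^ m)) ^ℚ K *ℚ c ^ℚ m       ≡⟨ cong (_*ℚ c ^ℚ m) (^-distrib-* (ℕtoℚ 2) (ℕtoℚ (N ^ m)) K) ⟩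
    (t *ℚ ℕtoℚ (N ^ m) ^ℚ K) *ℚ c ^ℚ m            ≡⟨ cong (λ z → (t *ℚ z) *ℚ c ^ℚ m) powers-commute ⟩
    (t *ℚ ℕtoℚ (N ^ K) ^ℚ m) *ℚ c ^ℚ m            ≡⟨ ℚP.*-assoc t _ _ ⟩
    t *ℚ (ℕtoℚ (N ^ K) ^ℚ m *ℚ c ^ℚ m)            ≡⟨ cong (t *ℚ_) (^-distrib-* (ℕtoℚ (N ^ K)) c m) ⟨
    t *ℚ u ^ℚ m ∎
    where
    open ≡-Reasoning
    powers-commute : ℕtoℚ (N ^ m) ^ℚ K ≡ ℕtoℚ (N ^ K) ^ℚ m
    powers-commute = begin
      ℕtoℚ (N ^ m) ^ℚ K   ≡⟨ ℕtoℚ-^ (N ^ m) K ⟩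
      ℕtoℚ ((N ^ m) ^ K)  ≡⟨ cong ℕtoℚ (trans (^-*-assoc N m K) (trans (cong (N ^_) (*-comm m K)) (sym (^-*-assoc N K m)))) ⟩
      ℕtoℚ ((N ^ K) ^ m)  ≡⟨ ℕtoℚ-^ (N ^ K) m ⟨
      ℕtoℚ (N ^ K) ^ℚ m   ∎

  threshold-pos : ∀ m → 0ℚ <ℚ threshold m
  threshold-pos m rewrite threshold-closed m = *-pos t>0 (^-pos m u>0)

  threshold-suc : ∀ m → threshold (suc m) ≡ threshold m *ℚ u
  threshold-suc m = begin
    threshold (suc m)       ≡⟨ threshold-closed (suc m) ⟩
    t *ℚ (u *ℚ u ^ℚ m)      ≡⟨ cong (t *ℚ_) (ℚP.*-comm u (u ^ℚ m)) ⟩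
    t *ℚ (u ^ℚ m *ℚ u)      ≡⟨ ℚP.*-assoc t (u ^ℚ m) u ⟨
    (t *ℚ u ^ℚ m) *ℚ u      ≡⟨ cong (_*ℚ u) (threshold-closed m) ⟨
    threshold m *ℚ u ∎
    where open ≡-Reasoning

  private
    few-classes-of-size : ∀ m D μ E → threshold m ≤ℚ ℕtoℚ μ ^ℚ K → D * μ ≤ E →
      ¬ (threshold (suc m) ≤ℚ ℕtoℚ E ^ℚ K) → ℕtoℚ D ^ℚ K ≤ℚ u
    few-classes-of-size m D μ E μ-heavy Dμ≤E E-light =
      ℚP.*-cancelˡ-≤-pos (threshold m) {{ℚ.positive (threshold-pos m)}} (begin
        threshold m *ℚ ℕtoℚ D ^ℚ K            ≡⟨ ℚP.*-comm (threshold m) _ ⟩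
        ℕtoℚ D ^ℚ K *ℚ threshold m            ≤⟨ *-mono-≤-nonNeg (^-nonNeg K (ℕtoℚ-nonNeg D)) (^-nonNeg K (ℕtoℚ-nonNeg μ))
                                                   ℚP.≤-refl μ-heavy ⟩
        ℕtoℚ D ^ℚ K *ℚ ℕtoℚ μ ^ℚ K            ≡⟨ ^-distrib-* (ℕtoℚ D) (ℕtoℚ μ) K ⟨
        (ℕtoℚ D *ℚ ℕtoℚ μ) ^ℚ K               ≡⟨ cong (_^ℚ K) (ℕtoℚ-* D μ) ⟨
        ℕtoℚ (D * μ) ^ℚ K                     ≤⟨ ℕtoℚ-^-mono K Dμ≤E ⟩
        ℕtoℚ E ^ℚ K                           ≤⟨ ℚP.<⇒≤ (ℚP.≰⇒> E-light) ⟩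
        threshold (suc m)                     ≡⟨ threshold-suc m ⟩
        threshold m *ℚ u ∎)
      where open ℚP.≤-Reasoning

  -- If a set of E points below threshold (m+1) contains disjoint classes indexed by bs, each
  -- reaching threshold m, then there are few classes:  |bs|^K ≤ u.  (The smallest class is used.)
  few-heavy-classes : ∀ m {B : Set} (bs : List B) (size : B → ℕ) E → 1 ≤ K →
    All (λ b → threshold m ≤ℚ ℕtoℚ (size b) ^ℚ K) bs → sumOver bs size ≤ E →
    ¬ (threshold (suc m) ≤ℚ ℕtoℚ E ^ℚ K) → ℕtoℚ (length bs) ^ℚ K ≤ℚ u
  few-heavy-classes m []       size E K≥1 heavy sum≤E E-light =
    ℚP.≤-trans (ℚP.≤-reflexive (0^ℚ K K≥1)) (ℚP.<⇒≤ u>0)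
  few-heavy-classes m (b ∷ bs) size E K≥1 heavy sum≤E E-light =
    few-classes-of-size m (length (b ∷ bs)) (size smallest) E
      (argmin-all size (All.head heavy) (All.tail heavy)) (≤-trans (length*min≤sumOver (b ∷ bs) (f[argmin]≤f[⊤] {f = size} b bs ∷ f[argmin]≤f[xs] {f = size} b bs)) sum≤E)
      E-light
    where smallest = argmin size b bs

  product-power : ∀ k s (w : Fin k → ℕ) → (∀ i → toℕ i < s → w i ≡ 1) → (∀ i → s ≤ toℕ i → ℕtoℚ (w i) ^ℚ K ≤ℚ u) →
    ℕtoℚ (productFin k w) ^ℚ K ≤ℚ u ^ℚ (k ∸ s)
  product-power zero s w ones smalls = ℚP.≤-reflexive (begin
    ℕtoℚ 1 ^ℚ K   ≡⟨ ℕtoℚ-^ 1 K ⟩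
    ℕtoℚ (1 ^ K)  ≡⟨ cong ℕtoℚ (^-zeroˡ K) ⟩
    1ℚ            ≡⟨ cong (u ^ℚ_) (0∸n≡0 s) ⟨
    u ^ℚ (0 ∸ s)  ∎)
    where open ≡-Reasoning
  product-power (suc k) zero w ones smalls = begin
    ℕtoℚ (w zero * W) ^ℚ K                   ≡⟨ cong (_^ℚ K) (ℕtoℚ-* (w zero) W) ⟩
    (ℕtoℚ (w zero) *ℚ ℕtoℚ W) ^ℚ K           ≡⟨ ^-distrib-* (ℕtoℚ (w zero)) (ℕtoℚ W) K ⟩
    ℕtoℚ (w zero) ^ℚ K *ℚ ℕtoℚ W ^ℚ K        ≤⟨ *-mono-≤-nonNeg (^-nonNeg K (ℕtoℚ-nonNeg (w zero))) (^-nonNeg k (ℚP.<⇒≤ u>0))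
                                                  (smalls zero z≤n)
                                                  (product-power k zero (λ i → w (suc i)) (λ i ()) (λ i _ → smalls (suc i) z≤n)) ⟩
    u *ℚ u ^ℚ k ∎
    where
    open ℚP.≤-Reasoning
    W = productFin k (λ i → w (suc i))
  product-power (suc k) (suc s) w ones smalls = begin
    ℕtoℚ (w zero * W) ^ℚ K   ≡⟨ cong (λ z → ℕtoℚ (z * W) ^ℚ K) (ones zero (s≤s z≤n)) ⟩
    ℕtoℚ (1 * W) ^ℚ K        ≡⟨ cong (λ z → ℕtoℚ z ^ℚ K) (*-identityˡ W) ⟩
    ℕtoℚ W ^ℚ K              ≤⟨ product-power k s (λ i → w (suc i)) (λ i i<s → ones (suc i) (s≤s i<s))
                                   (λ i s≤i → smalls (suc i) (s≤s s≤i)) ⟩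
    u ^ℚ (k ∸ s) ∎
    where
    open ℚP.≤-Reasoning
    W = productFin k (λ i → w (suc i))

  doubling : ∀ m W e → 1 ≤ K → ℕtoℚ W ^ℚ K ≤ℚ u ^ℚ m → threshold m ≤ℚ ℕtoℚ e ^ℚ K → 2 * W ≤ e
  doubling m W e K≥1 W-small e-heavy = ≮⇒≥ λ e<2W →
    <⇒≱ (^-monoˡ-< K {{>-nonZero K≥1}} e<2W) (ℕtoℚ-cancel-≤ (begin
      ℕtoℚ ((2 * W) ^ K)              ≡⟨ ℕtoℚ-^ (2 * W) K ⟨
      ℕtoℚ (2 * W) ^ℚ K               ≡⟨ cong (_^ℚ K) (ℕtoℚ-* 2 W) ⟩
      (ℕtoℚ 2 *ℚ ℕtoℚ W) ^ℚ K         ≡⟨ ^-distrib-* (ℕtoℚ 2) (ℕtoℚ W) K ⟩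
      t *ℚ ℕtoℚ W ^ℚ K                ≤⟨ ℚP.*-monoˡ-≤-nonNeg t {{ℚ.nonNegative (ℚP.<⇒≤ t>0)}} W-small ⟩
      t *ℚ u ^ℚ m                     ≡⟨ threshold-closed m ⟨
      threshold m                     ≤⟨ e-heavy ⟩
      ℕtoℚ e ^ℚ K                     ≡⟨ ℕtoℚ-^ e K ⟩
      ℕtoℚ (e ^ K) ∎))
    where open ℚP.≤-Reasoning

sumOver-fibres≤count : ∀ {T V : Set} (π : T → V) (_≟_ : DecidableEquality V) {P : T → Set} (P? : Decidable P)
  (L : List T) (Vs : List V) → Unique Vs → sumOver Vs (λ v → count (P? ∩? (λ x → π x ≟ v)) L) ≤ count P? L
sumOver-fibres≤count π _≟_ P? L []       []          = z≤n
sumOver-fibres≤count {V = V} π _≟_ {P} P? L (v ∷ Vs) (v∉Vs ∷ u) = begin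
  count (P? ∩? fibre v) L + sumOver Vs (λ w → count (P? ∩? fibre w) L)
    ≡⟨ cong (count (P? ∩? fibre v) L +_) (sumOver-congAll Vs (All.map (λ v≢w → count-cong _ _ (off-v v≢w) (λ _ q → proj₁ (proj₁ q) , proj₂ q) L) v∉Vs)) ⟩
  count (P? ∩? fibre v) L + sumOver Vs (λ w → count ((P? ∩? ∁? (fibre v)) ∩? fibre w) L)
    ≤⟨ +-monoʳ-≤ _ (sumOver-fibres≤count π _≟_ (P? ∩? ∁? (fibre v)) L Vs u) ⟩
  count (P? ∩? fibre v) L + count (P? ∩? ∁? (fibre v)) L
    ≡⟨ count-split P? (fibre v) L ⟨
  count P? L ∎
  where
  open ≤-Reasoning
  fibre : ∀ w → Decidable (λ x → π x ≡ w)
  fibre w x = π x ≟ w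
  off-v : ∀ {w} → v ≢ w → ∀ x → P x × π x ≡ w → (P x × π x ≢ v) × π x ≡ w
  off-v v≢w x (px , πx≡w) = (px , λ πx≡v → v≢w (trans (sym πx≡v) πx≡w)) , πx≡w
  sumOver-congAll : ∀ (xs : List V) {f g : V → ℕ} → All (λ x → f x ≡ g x) xs → sumOver xs f ≡ sumOver xs g
  sumOver-congAll []       []         = refl
  sumOver-congAll (x ∷ xs) (e ∷ es) = cong₂ _+_ e (sumOver-congAll xs es)

allPoints-unique : ∀ p n → Unique (allPoints p n)
allPoints-unique p zero    = [] ∷ []
allPoints-unique p (suc n) = UniqueP.concat⁺
  (AllP.map⁺ (All.tabulate (λ _ → UniqueP.map⁺ VecP.∷-injectiveʳ (allPoints-unique p n))))
  (AllPairsP.map⁺ (AllPairs.map different-heads (UniqueP.allFin⁺ p)))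
  where
  different-heads : ∀ {a b : Fin p} → a ≢ b → Disjoint (map (a ∷_) (allPoints p n)) (map (b ∷_) (allPoints p n))
  different-heads a≢b (v∈a , v∈b) with ∈-map⁻ _ v∈a | ∈-map⁻ _ v∈b
  ... | _ , _ , refl | _ , _ , e = a≢b (VecP.∷-injectiveˡ e)

residue-unique : ∀ p .{{_ : NonZero p}} S S' a b → p ∣ S → p ∣ S' → S + b ≡ S' + a → a < p → b < p → a ≡ b
residue-unique p S S' a b p∣S p∣S' S+b≡S'+a a<p b<p = begin
  a               ≡⟨ m<n⇒m%n≡m a<p ⟨
  a % p           ≡⟨ %-remove-+ˡ a p∣S' ⟨
  (S' + a) % p    ≡⟨ cong (_% p) S+b≡S'+a ⟨
  (S + b) % p     ≡⟨ %-remove-+ˡ b p∣S ⟩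
  b % p           ≡⟨ m<n⇒m%n≡m b<p ⟩
  b ∎
  where open ≡-Reasoning

sumFin-cong : ∀ k (f g : Fin k → ℕ) → (∀ i → f i ≡ g i) → sumFin k f ≡ sumFin k g
sumFin-cong zero    f g f≗g = refl
sumFin-cong (suc k) f g f≗g = cong₂ _+_ (f≗g zero) (sumFin-cong k _ _ (λ i → f≗g (suc i)))

sumFin-exchange : ∀ k (h h' : Fin k → ℕ) (d : Fin k) → (∀ i → i ≢ d → h i ≡ h' i) →
  sumFin k h + h' d ≡ sumFin k h' + h d
sumFin-exchange (suc k) h h' zero agree
  rewrite sumFin-cong k (λ i → h (suc i)) (λ i → h' (suc i)) (λ i → agree (suc i) (λ ()))
  = solve 3 (λ a b s → a :+ s :+ b := b :+ s :+ a) refl (h zero) (h' zero) (sumFin k (λ i → h' (suc i)))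
sumFin-exchange (suc k) h h' (suc d) agree
  rewrite +-assoc (h zero) (sumFin k (λ i → h (suc i))) (h' (suc d))
        | +-assoc (h' zero) (sumFin k (λ i → h' (suc i))) (h (suc d))
        | sumFin-exchange k (λ i → h (suc i)) (λ i → h' (suc i)) d (λ i i≢d → agree (suc i) (i≢d ∘ Fin-suc-injective))
  = cong (_+ (sumFin k (λ i → h' (suc i)) + h (suc d))) (agree zero (λ ()))

zero-sum-determined : ∀ {p n k} .{{_ : NonZero p}} (x y : Fin k → Point p n) (d : Fin k) →
  (∀ c → p ∣ sumFin k (λ i → toℕ (lookup (x i) c))) → (∀ c → p ∣ sumFin k (λ i → toℕ (lookup (y i) c))) →
  (∀ i → i ≢ d → x i ≡ y i) → x d ≡ y d
zero-sum-determined {p} {k = k} x y d x-sum y-sum agree = begin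
  x d                              ≡⟨ VecP.tabulate∘lookup (x d) ⟨
  tabulate (lookup (x d))          ≡⟨ VecP.tabulate-cong same-coordinate ⟩
  tabulate (lookup (y d))          ≡⟨ VecP.tabulate∘lookup (y d) ⟩
  y d ∎
  where
  open ≡-Reasoning
  same-coordinate : ∀ c → lookup (x d) c ≡ lookup (y d) c
  same-coordinate c = FinP.toℕ-injective (residue-unique p _ _ _ _ (x-sum c) (y-sum c)
    (sumFin-exchange k (λ i → toℕ (lookup (x i) c)) (λ i → toℕ (lookup (y i) c)) d
      (λ i i≢d → cong (λ v → toℕ (lookup v c)) (agree i i≢d)))
    (FinP.toℕ<n _) (FinP.toℕ<n _))

∈-initSeg⁻ : ∀ {k} m {i : Fin k} → i ∈ₛ initSeg m → toℕ i < m
∈-initSeg⁻ m {i} i∈ = <ᵇ⇒< (toℕ i) m (subst T (trans (sym (VecP.[]=⇒lookup i∈)) (VecP.lookup∘tabulate _ i)) tt)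

∈-initSeg⁺ : ∀ {k} m {i : Fin k} → toℕ i < m → i ∈ₛ initSeg m
∈-initSeg⁺ m {i} i<m = VecP.lookup⇒[]= i (initSeg m) (trans (VecP.lookup∘tabulate _ i) (T⇒≡true (<⇒<ᵇ i<m)))
  where
  T⇒≡true : ∀ {b} → T b → b ≡ true
  T⇒≡true {true} _ = refl

∣initSeg∣ : ∀ {k} m → m ≤ k → ∣ initSeg {k} m ∣ ≡ m
∣initSeg∣ {zero}  zero    _         = refl
∣initSeg∣ {suc k} zero    _         = ∣initSeg∣ {k} zero z≤n
∣initSeg∣ {suc k} (suc m) (s≤s m≤k) = cong suc (∣initSeg∣ {k} m m≤k)

private
  ∣[0]∪∅∣ : ∀ k → ∣ initSeg {k} 0 ∪ ∅ ∣ ≡ 0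
  ∣[0]∪∅∣ zero    = refl
  ∣[0]∪∅∣ (suc k) = ∣[0]∪∅∣ k

∣initSeg∪⁅j⁆∣ : ∀ {k} m (j : Fin k) → m ≤ toℕ j → ∣ initSeg {k} m ∪ ⁅ j ⁆ ∣ ≡ suc m
∣initSeg∪⁅j⁆∣ {suc k} zero    zero    _       = cong suc (∣[0]∪∅∣ k)
∣initSeg∪⁅j⁆∣ {suc k} zero    (suc j) _       = ∣initSeg∪⁅j⁆∣ {k} zero j z≤n
∣initSeg∪⁅j⁆∣ {suc k} (suc m) (suc j) (s≤s h) = cong suc (∣initSeg∪⁅j⁆∣ {k} m j h)

module Tuples (p n k : ℕ) (X : Fin k → Point p n → Bool) where

  open Setup p n k X

  _≟ₚ_ : DecidableEquality (Point p n)
  _≟ₚ_ = VecP.≡-dec FinP._≟_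

  agreeOn-isEquivalence : ∀ I → IsEquivalence (AgreeOn I)
  agreeOn-isEquivalence I = record
    { refl  = λ _ _ → refl
    ; sym   = λ y≈x i i∈I → sym (y≈x i i∈I)
    ; trans = λ x≈y y≈z i i∈I → trans (y≈z i i∈I) (x≈y i i∈I)
    }

  numExt-resp : ∀ I {y y'} → AgreeOn I y y' → numExt I y ≡ numExt I y'
  numExt-resp I y≈y' = count-cong (agreeOn? I _) (agreeOn? I _)
    (λ x y≈x i i∈I → trans (y≈x i i∈I) (sym (y≈y' i i∈I))) (λ x y'≈x i i∈I → trans (y'≈x i i∈I) (y≈y' i i∈I)) cycles

  Bad-resp : ∀ θ δ' I {y y'} → AgreeOn I y y' → Bad θ δ' I y → Bad θ δ' I y'
  Bad-resp θ δ' I y≈y' = subst (λ e → _ ≤ℚ ℕtoℚ e ^ℚ (k ∸ 2)) (numExt-resp I y≈y')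

  replaceAt : Tuple → Fin k → Point p n → Tuple
  replaceAt y j v = updateAt y j (const v)

  agree-replace⁻ : ∀ {I y j v x} → j ∉ₛ I → AgreeOn (I ∪ ⁅ j ⁆) (replaceAt y j v) x → AgreeOn I y x × x j ≡ v
  agree-replace⁻ {I} {y} {j} {v} j∉I agree =
    (λ i i∈I → trans (agree i (x∈p∪q⁺ (inj₁ i∈I))) (updateAt-minimal i j y (λ { refl → j∉I i∈I }))) ,
    trans (agree j (x∈p∪q⁺ {p = I} (inj₂ (x∈⁅x⁆ j)))) (updateAt-updates j y)

  agree-replace⁺ : ∀ {I y j v x} → j ∉ₛ I → AgreeOn I y x → x j ≡ v → AgreeOn (I ∪ ⁅ j ⁆) (replaceAt y j v) x
  agree-replace⁺ {I} {y} {j} {v} j∉I agree xj≡v i i∈ with x∈p∪q⁻ I ⁅ j ⁆ i∈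
  ... | inj₁ i∈I = trans (agree i i∈I) (sym (updateAt-minimal i j y (λ { refl → j∉I i∈I })))
  ... | inj₂ i∈j rewrite x∈⁅y⁆⇒x≡y j i∈j = trans xj≡v (sym (updateAt-updates j y))

-- The lemma for fixed data.  It only needs p ≠ 0 and  1 ≤ ℓ ≤ k - 2;  the size of δ' and the
-- degree bound θ enter only through θδ' > 0.
module HalfOfM0 (p n k : ℕ) {{p≢0 : NonZero p}} (X : Fin k → Point p n → Bool)
                (θ δ' : ℚ) (θδ'>0 : 0ℚ <ℚ θ *ℚ δ') (ℓ : ℕ) (ℓ≥1 : 1 ≤ ℓ) (ℓ≤k∸2 : ℓ ≤ k ∸ 2) where

  open Setup p n k X
  open Tuples p n k X

  K : ℕ
  K = k ∸ 2

  open Threshold N K (θ *ℚ δ') θδ'>0 (m^n>0 p n)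

  -- m = k - ℓ - 1 counts the coordinates ℓ+2, …, k (paper indexing) constrained in M'; a bad
  -- [ℓ]-tuple has at least  threshold m  extensions.
  m : ℕ
  m = k ∸ ℓ ∸ 1

  K≥1 : 1 ≤ K
  K≥1 = ≤-trans ℓ≥1 ℓ≤k∸2

  ℓ+2≤k : ℓ + 2 ≤ k
  ℓ+2≤k = ≤-trans (+-monoˡ-≤ 2 ℓ≤k∸2) (≤-reflexive (m∸n+n≡m (<⇒≤ (m∸n≢0⇒n<m {k} {2} (λ K≡0 → <⇒≢ K≥1 (sym K≡0))))))

  ℓ<k : ℓ < k
  ℓ<k = <-≤-trans (m<m+n ℓ (s≤s z≤n)) ℓ+2≤k

  1+[ℓ∸1]≡ℓ : suc (ℓ ∸ 1) ≡ ℓ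
  1+[ℓ∸1]≡ℓ = trans (+-comm 1 (ℓ ∸ 1)) (m∸n+n≡m ℓ≥1)

  Bad⇒threshold : ∀ {I y} s → ∣ I ∣ ≡ s → Bad θ δ' I y → threshold (k ∸ s ∸ 1) ≤ℚ ℕtoℚ (numExt I y) ^ℚ K
  Bad⇒threshold s refl bad = bad

  -- The paper's index set [ℓ-1] (positions 0, …, ℓ-2 here) and its extensions [ℓ-1] ∪ {j}.
  low : Subset k
  low = initSeg (ℓ ∸ 1)

  ∣low∪⁅j⁆∣ : ∀ j → ℓ < toℕ j → ∣ low ∪ ⁅ j ⁆ ∣ ≡ ℓ
  ∣low∪⁅j⁆∣ j ℓ<j = trans (∣initSeg∪⁅j⁆∣ (ℓ ∸ 1) j (≤-trans (m∸n≤m ℓ 1) (<⇒≤ ℓ<j))) 1+[ℓ∸1]≡ℓ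

  low-free : k ∸ ∣ low ∣ ∸ 1 ≡ suc m
  low-free = begin
    k ∸ ∣ low ∣ ∸ 1        ≡⟨ cong (λ s → k ∸ s ∸ 1) (∣initSeg∣ (ℓ ∸ 1) (≤-trans (m∸n≤m ℓ 1) (<⇒≤ ℓ<k))) ⟩
    k ∸ (ℓ ∸ 1) ∸ 1        ≡⟨ ∸-+-assoc k (ℓ ∸ 1) 1 ⟩
    k ∸ (ℓ ∸ 1 + 1)        ≡⟨ cong (k ∸_) (trans (+-comm (ℓ ∸ 1) 1) 1+[ℓ∸1]≡ℓ) ⟩
    k ∸ ℓ                  ≡⟨ suc-pred (k ∸ ℓ) {{>-nonZero (m<n⇒0<n∸m ℓ<k)}} ⟨
    suc m ∎
    where open ≡-Reasoning

  -- The classes of the double counting: cycles with the same first ℓ coordinates.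
  _≈ℓ_ : Tuple → Tuple → Set
  _≈ℓ_ = AgreeOn (initSeg ℓ)

  ≈ℓ⇒low : ∀ {y x} → y ≈ℓ x → AgreeOn low y x
  ≈ℓ⇒low y≈x i i∈low = y≈x i (∈-initSeg⁺ ℓ (<-≤-trans (∈-initSeg⁻ (ℓ ∸ 1) i∈low) (m∸n≤m ℓ 1)))

  InM0-resp : ∀ {y x} → y ≈ℓ x → InM0 θ δ' ℓ y → InM0 θ δ' ℓ x
  InM0-resp {y} {x} y≈x (bad , ¬low-bad) =
    Bad-resp θ δ' (initSeg ℓ) y≈x bad ,
    (λ low-bad → ¬low-bad (Bad-resp θ δ' low (IsEquivalence.sym (agreeOn-isEquivalence low) (≈ℓ⇒low y≈x)) low-bad))

  -- The position ℓ (paper: ℓ+1), which a cycle determines from the other coordinates.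
  d : Fin k
  d = fromℕ< ℓ<k

  module Class (z : Tuple) (z∈M0 : InM0 θ δ' ℓ z) where

    G : Fin k → Point p n → Set
    G j v = Bad θ δ' (low ∪ ⁅ j ⁆) (replaceAt z j v)

    G? : ∀ j → Decidable (G j)
    G? j v = bad? θ δ' (low ∪ ⁅ j ⁆) (replaceAt z j v)

    D : Fin k → ℕ
    D j = count (G? j) (allPoints p n)

    ext : Fin k → Point p n → ℕ
    ext j v = count (agreeOn? low z ∩? (λ x → x j ≟ₚ v)) cycles

    j∉low : ∀ {j} → ℓ < toℕ j → j ∉ₛ low
    j∉low ℓ<j j∈low = <-asym (<-≤-trans (∈-initSeg⁻ (ℓ ∸ 1) j∈low) (m∸n≤m ℓ 1)) ℓ<j

    numExt-replace : ∀ j v → ℓ < toℕ j → numExt (low ∪ ⁅ j ⁆) (replaceAt z j v) ≡ ext j v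
    numExt-replace j v ℓ<j = count-cong _ _
      (λ x agree → agree-replace⁻ (j∉low ℓ<j) agree)
      (λ x (agree , xj≡v) → agree-replace⁺ (j∉low ℓ<j) agree xj≡v) cycles

    -- Each coordinate j > ℓ has few bad choices:  D_j^K ≤ u.  The classes {x_j = v} of the
    -- extensions of the non-bad [ℓ-1]-tuple are disjoint, and those with v bad are heavy.
    few-bad-choices : ∀ j → ℓ < toℕ j → ℕtoℚ (D j) ^ℚ K ≤ℚ u
    few-bad-choices j ℓ<j = few-heavy-classes m bad-values (ext j) (numExt low z) K≥1 heavy
      (sumOver-fibres≤count (λ x → x j) _≟ₚ_ (agreeOn? low z) cycles bad-values
        (UniqueP.filter⁺ (G? j) (allPoints-unique p n)))
      (λ low-bad → proj₂ z∈M0 (subst (λ s → threshold s ≤ℚ ℕtoℚ (numExt low z) ^ℚ K) (sym low-free) low-bad))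
      where
      bad-values = filter (G? j) (allPoints p n)
      heavy : All (λ v → threshold m ≤ℚ ℕtoℚ (ext j v) ^ℚ K) bad-values
      heavy = All.tabulate λ {v} v∈ → subst (λ e → threshold m ≤ℚ ℕtoℚ e ^ℚ K) (numExt-replace j v ℓ<j)
        (Bad⇒threshold ℓ (∣low∪⁅j⁆∣ j ℓ<j) (proj₂ (∈-filter⁻ (G? j) {xs = allPoints p n} v∈)))

    w : Fin k → ℕ
    w i = if does (ℓ <? toℕ i) then D i else 1

    w-high : ∀ i → ℓ < toℕ i → w i ≡ D i
    w-high i ℓ<i = cong (if_then D i else 1) (dec-true (ℓ <? toℕ i) ℓ<i)

    w-low : ∀ i → ¬ ℓ < toℕ i → w i ≡ 1
    w-low i ℓ≮i = cong (if_then D i else 1) (dec-false (ℓ <? toℕ i) ℓ≮i)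

    Q : Fin k → Point p n → Set
    Q i v = (toℕ i < ℓ → v ≡ z i) × (ℓ < toℕ i → G i v)

    Q? : ∀ i → Decidable (Q i)
    Q? i v = ((toℕ i <? ℓ) →-dec (v ≟ₚ z i)) ×-dec ((ℓ <? toℕ i) →-dec G? i v)

    Q-size : ∀ i → i ≢ d → count (Q? i) (allPoints p n) ≤ w i
    Q-size i i≢d = by-position (<-cmp (toℕ i) ℓ)
      where
      by-position : Tri (toℕ i < ℓ) (toℕ i ≡ ℓ) (ℓ < toℕ i) → count (Q? i) (allPoints p n) ≤ w i
      by-position (tri< i<ℓ _ _) = subst (count (Q? i) (allPoints p n) ≤_) (sym (w-low i (<-asym i<ℓ)))
        (count-subsingleton (Q? i) (λ qa qb → trans (proj₁ qa i<ℓ) (sym (proj₁ qb i<ℓ))) (allPoints p n) (allPoints-unique p n))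
      by-position (tri≈ _ i≡ℓ _) = ⊥-elim (i≢d (FinP.toℕ-injective (trans i≡ℓ (sym (FinP.toℕ-fromℕ< ℓ<k)))))
      by-position (tri> _ _ ℓ<i) = subst (count (Q? i) (allPoints p n) ≤_) (sym (w-high i ℓ<i))
        (count-mono (Q? i) (G? i) (λ v q → proj₂ q ℓ<i) (allPoints p n))

    InClassM' : Tuple → Set
    InClassM' x = (InM' θ δ' ℓ x × z ≈ℓ x) × IsCycle x

    inClassM'? : Decidable InClassM'
    inClassM'? = (inM'? θ δ' ℓ ∩? agreeOn? (initSeg ℓ) z) ∩? isCycle?

    in-Q : ∀ x → InClassM' x → ∀ i → i ≢ d → Q i (x i)
    in-Q x ((x∈M' , z≈x) , _) i _ =
      (λ i<ℓ → z≈x i (∈-initSeg⁺ ℓ i<ℓ)) ,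
      (λ ℓ<i → Bad-resp θ δ' (low ∪ ⁅ i ⁆) (IsEquivalence.sym (agreeOn-isEquivalence _)
                  (agree-replace⁺ (j∉low ℓ<i) (≈ℓ⇒low z≈x) refl)) (proj₂ x∈M' i ℓ<i))

    class-M'-bound : count (inM'? θ δ' ℓ ∩? agreeOn? (initSeg ℓ) z) cycles ≤ productFin k w
    class-M'-bound = subst (_≤ productFin k w) (sym (count-filter _ isCycle? (allFuns k (allPoints p n))))
      (FunctionCount.count-box-determined (allPoints p n) (allPoints-unique p n) k d inClassM'? Q? w
        (≤-reflexive (sym (w-low d (λ ℓ<d → <-irrefl (sym (FinP.toℕ-fromℕ< ℓ<k)) ℓ<d))))
        Q-size in-Q
        (λ {x} {y} x∈ y∈ → zero-sum-determined x y d (proj₂ (proj₂ x∈)) (proj₂ (proj₂ y∈))))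

    class-M0-size : count (inM0? θ δ' ℓ ∩? agreeOn? (initSeg ℓ) z) cycles ≡ numExt (initSeg ℓ) z
    class-M0-size = count-cong _ _ (λ _ → proj₂) (λ x z≈x → InM0-resp z≈x z∈M0 , z≈x) cycles

    half-in-class : 2 * count (inM'? θ δ' ℓ ∩? agreeOn? (initSeg ℓ) z) cycles ≤ count (inM0? θ δ' ℓ ∩? agreeOn? (initSeg ℓ) z) cycles
    half-in-class = begin
      2 * count (inM'? θ δ' ℓ ∩? agreeOn? (initSeg ℓ) z) cycles  ≤⟨ *-monoʳ-≤ 2 class-M'-bound ⟩
      2 * productFin k w                                          ≤⟨ doubling m (productFin k w) (numExt (initSeg ℓ) z) K≥1
                                                                       product-small
                                                                       (Bad⇒threshold ℓ (∣initSeg∣ ℓ (<⇒≤ ℓ<k)) (proj₁ z∈M0)) ⟩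
      numExt (initSeg ℓ) z                                        ≡⟨ class-M0-size ⟨
      count (inM0? θ δ' ℓ ∩? agreeOn? (initSeg ℓ) z) cycles ∎
      where
      open ≤-Reasoning
      product-small : ℕtoℚ (productFin k w) ^ℚ K ≤ℚ u ^ℚ m
      product-small = subst (λ s → ℕtoℚ (productFin k w) ^ℚ K ≤ℚ u ^ℚ s) (sym (trans (∸-+-assoc k ℓ 1) (cong (k ∸_) (+-comm ℓ 1))))
        (product-power k (suc ℓ) w (λ i i<1+ℓ → w-low i (≤⇒≯ (≤-pred i<1+ℓ)))
          (λ i ℓ<i → subst (λ e → ℕtoℚ e ^ℚ K ≤ℚ u) (sym (w-high i ℓ<i)) (few-bad-choices i ℓ<i)))

  half-in-every-class : ∀ z → 2 * count (inM'? θ δ' ℓ ∩? agreeOn? (initSeg ℓ) z) cycles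
                              ≤ count (inM0? θ δ' ℓ ∩? agreeOn? (initSeg ℓ) z) cycles
  half-in-every-class z = by-membership (inM0? θ δ' ℓ z)
    where
    by-membership : Dec (InM0 θ δ' ℓ z) → 2 * count (inM'? θ δ' ℓ ∩? agreeOn? (initSeg ℓ) z) cycles
                                          ≤ count (inM0? θ δ' ℓ ∩? agreeOn? (initSeg ℓ) z) cycles
    by-membership (yes z∈M0) = Class.half-in-class z z∈M0
    by-membership (no  z∉M0) = ≤-trans (≤-reflexive (cong (2 *_) (count-none _ no-M' cycles))) z≤n
      where
      no-M' : ∀ x → ¬ (InM' θ δ' ℓ x × z ≈ℓ x)
      no-M' x (x∈M' , z≈x) = z∉M0 (InM0-resp (IsEquivalence.sym (agreeOn-isEquivalence _) z≈x) (proj₁ x∈M'))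

  half : 2 * sizeM' θ δ' ℓ ≤ sizeM0 θ δ' ℓ
  half = count-half-by-classes (agreeOn? (initSeg ℓ)) (agreeOn-isEquivalence (initSeg ℓ))
           (inM0? θ δ' ℓ) (inM'? θ δ' ℓ) cycles half-in-every-class

lemma2p2 : (p n k : ℕ) → Prime p → 4 ≤ k → 1 ≤ n
    → (X : Fin k → Point p n → Bool)
    → (δ' : ℚ) → 0ℚ <ℚ δ'
    → δ' *ℚ ℕtoℚ ((p ^ n) ^ (k ∸ 1)) ≡ ℕtoℚ (Setup.numCycles p n k X)
    → (θ : ℚ) → 1ℚ ≤ℚ θ
    → (∀ (i : Fin k) (v : Point p n) → X i v ≡ true
    → ℕtoℚ (Setup.numCyclesAt p n k X i v) ≤ℚ θ *ℚ δ' *ℚ ℕtoℚ ((p ^ n) ^ (k ∸ 2)))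
    → (ℓ : ℕ) → 2 ≤ ℓ → ℓ ≤ k ∸ 2
    → 2 * Setup.sizeM' p n k X θ δ' ℓ ≤ Setup.sizeM0 p n k X θ δ' ℓ
lemma2p2 p n k p-prime _ _ X δ' δ'>0 _ θ θ≥1 _ ℓ ℓ≥2 ℓ≤k∸2 =
  HalfOfM0.half p n k {{prime⇒nonZero p-prime}} X θ δ' θδ'>0 ℓ (≤-trans (s≤s z≤n) ℓ≥2) ℓ≤k∸2
  where
  θδ'>0 : 0ℚ <ℚ θ *ℚ δ'
  θδ'>0 = *-pos (ℚP.<-≤-trans (ℚP.positive⁻¹ 1ℚ) θ≥1) δ'>0
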